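{- Let $c$ be a stroll-nonrepetitive coloring of a path $P=v_1\cdots v_n$ with colors in $\{1,2,3\}$. Then the $SA$-sequence of $c$ is $\mathcal{H}$-free, where $\mathcal{H}=\{SS,\ AAAA,\ ASASA,\ AASAASAA,\ AAASAAASAAA\}$.
   Context: A walk is a sequence $v_1\cdots v_r$ of vertices with consecutive vertices adjacent. A sequence $a_1\cdots a_{2t}$ is repetitive if $a_i=a_{i+t}$ for all $i\in\{1,\dots,t\}$. A walk $v_1\cdots v_{2t}$ is a stroll if $v_i\neq v_{i+t}$ for every $i\in\{1,\dots,t\}$; a coloring $c$ is stroll-nonrepetitive if for no stroll $v_1\cdots v_{2t}$ is $c(v_1)\cdots c(v_{2t})$ repetitive. For a coloring $c$ of the path $v_1\cdots v_n$, the $SA$-sequence of $c$ is the word $a_2\cdots a_{n-1}$ over the alphabet $\{S,A\}$ where $a_i=S$ if $c(v_{i-1})=c(v_{i+1})$ and $a_i=A$ otherwise. A subword of a word is any sequence of consecutive letters of it. A word is $\mathcal{H}$-free if none of its subwords belongs to $\mathcal{H}$. -}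

module Defs where

open import Data.Nat using (ℕ; zero; suc; _+_; _<_; _≤_)
open import Data.Fin using (Fin; toℕ) renaming (zero to fz; suc to fs)
import Data.Fin as Fin
open import Data.List using (List; []; _∷_; _++_)
open import Data.List.Membership.Propositional using (_∈_)
open import Data.Product using (Σ; ∃; _×_; _,_)
open import Data.Sum using (_⊎_)
open import Relation.Nullary using (¬_; yes; no)
open import Relation.Binary.PropositionalEquality using (_≡_; _≢_)

-- The path P = v_1 ⋯ v_n has vertex set Fin n (vertex v_{k+1} is index k);
-- v_i and v_j are adjacent iff their indices differ by exactly one.
Adj : {n : ℕ} → Fin n → Fin n → Set
Adj u v = suc (toℕ u) ≡ toℕ v ⊎ suc (toℕ v) ≡ toℕ u

-- A sequence w 0, w 1, …, w (r-1) of vertices (given as a function ℕ → Fin n,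
-- only its first r values matter) is a walk of r vertices.
IsWalk : {n : ℕ} → ℕ → (ℕ → Fin n) → Set
IsWalk r w = ∀ i → suc i < r → Adj (w i) (w (suc i))

IsStroll : {n : ℕ} → ℕ → (ℕ → Fin n) → Set
IsStroll t w = IsWalk (t + t) w × (∀ i → i < t → w i ≢ w (i + t))

Repetitive : {A : Set} → ℕ → (ℕ → A) → Set
Repetitive t a = ∀ i → i < t → a i ≡ a (i + t)

StrollNonrepetitive : {n : ℕ} → (Fin n → Fin 3) → Set
StrollNonrepetitive {n} c =
  ∀ (t : ℕ) → 1 ≤ t → (w : ℕ → Fin n) → IsStroll t w →
    ¬ Repetitive t (λ i → c (w i))

data SA : Set where
  S A : SA

letter : Fin 3 → Fin 3 → SA
letter x y with x Fin.≟ y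
... | yes _ = S
... | no _ = A

-- SA-sequence a_2 ⋯ a_{n-1}: a_i = S iff c(v_{i-1}) = c(v_{i+1}).
saSeq : (n : ℕ) → (Fin n → Fin 3) → List SA
saSeq (suc (suc (suc n))) c =
  letter (c fz) (c (fs (fs fz))) ∷ saSeq (suc (suc n)) (λ i → c (fs i))
saSeq _ _ = []

Subword : {X : Set} → List X → List X → Set
Subword {X} u w = Σ (List X) λ p → Σ (List X) λ s → w ≡ p ++ (u ++ s)

Free : {X : Set} → List (List X) → List X → Set
Free H w = ∀ u → u ∈ H → ¬ Subword u w

ℋ : List (List SA)
ℋ = (S ∷ S ∷ [])
  ∷ (A ∷ A ∷ A ∷ A ∷ [])
  ∷ (A ∷ S ∷ A ∷ S ∷ A ∷ [])
  ∷ (A ∷ A ∷ S ∷ A ∷ A ∷ S ∷ A ∷ A ∷ [])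
  ∷ (A ∷ A ∷ A ∷ S ∷ A ∷ A ∷ A ∷ S ∷ A ∷ A ∷ A ∷ [])
  ∷ []

{-# OPTIONS --safe #-}
-- A stroll-nonrepetitive colouring is proper (a repetitive stroll with t = 1 is an
-- edge with equal colours), and in a proper 3-colouring the SA-letter at v_{i+1}
-- determines c(v_{i+2}) from c(v_i) and c(v_{i+1}): S repeats c(v_i), A takes the
-- third colour. So on a window spelling a word u of ℋ the colouring is fixed up to
-- the choice of its first two colours, and for each of these six colourings the
-- stroll that runs to the end of the window and turns back is repetitive.
module Submission where

open import Defs
open import Data.Nat using (ℕ; zero; suc; _+_; _<_; _≤_; z≤n; s≤s; _<?_; ∣_-_∣)
import Data.Nat as ℕ
open import Data.Nat.Properties using (allUpTo?; +-suc; +-cancelˡ-≡; 1+n≢n; m∸n≤m; n<1+n; <-trans)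
open import Data.Fin using (Fin; toℕ; fromℕ<; inject≤; _≟_) renaming (zero to fz; suc to fs)
open import Data.Fin.Patterns using (0F; 1F; 2F)
open import Data.Fin.Properties using (all?; toℕ-injective; toℕ-inject≤)
open import Data.List using (List; []; _∷_; _++_; length)
open import Data.List.Properties using (∷-injectiveˡ; ∷-injectiveʳ)
open import Data.List.Relation.Unary.Any using (here; there)
open import Data.Product using (Σ-syntax; _×_; _,_)
open import Data.Sum using (inj₁; inj₂)
import Data.Sum as Sum
open import Function using (_∘_)
open import Relation.Nullary using (¬_; Dec; yes; no; ¬?)
open import Relation.Nullary.Decidable using (True; toWitness; from-yes; map′; _×-dec_; _⊎-dec_; _→-dec_)
open import Relation.Binary.PropositionalEquality using (_≡_; _≢_; refl; sym; trans; cong; cong₂; module ≡-Reasoning)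
open ≡-Reasoning

Proper : ∀ {n} → (Fin n → Fin 3) → Set
Proper c = ∀ {i j} → Adj i j → c i ≢ c j

adj⇒≢ : ∀ {n} {u v : Fin n} → Adj u v → u ≢ v
adj⇒≢ (inj₁ e) refl = 1+n≢n e
adj⇒≢ (inj₂ e) refl = 1+n≢n e

strollNonrepetitive⇒proper : ∀ {n} {c : Fin n → Fin 3} → StrollNonrepetitive c → Proper c
strollNonrepetitive⇒proper {n} {c} snr {u} {v} uv cu≡cv =
  snr 1 (s≤s z≤n) w (walk , apart) λ { zero _ → cu≡cv ; (suc _) (s≤s ()) }
  where
  w : ℕ → Fin n
  w zero    = u
  w (suc _) = v
  walk : IsWalk 2 w
  walk zero    _                = uv
  walk (suc _) (s≤s (s≤s ()))
  apart : ∀ i → i < 1 → w i ≢ w (i + 1)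
  apart zero    _         = adj⇒≢ uv
  apart (suc _) (s≤s ())

strollNonrepetitive-subpath : ∀ {m n} {c : Fin n → Fin 3} (k : ℕ) (f : Fin m → Fin n) →
  (∀ i → toℕ (f i) ≡ k + toℕ i) → StrollNonrepetitive c → StrollNonrepetitive (c ∘ f)
strollNonrepetitive-subpath k f f≡k+ snr t t≥1 w (walk , apart) =
  snr t t≥1 (f ∘ w)
    ((λ i i< → Sum.map shift shift (walk i i<)) , λ i i<t → apart i i<t ∘ f-injective)
  where
  shift : ∀ {i j} → suc (toℕ i) ≡ toℕ j → suc (toℕ (f i)) ≡ toℕ (f j)
  shift {i} {j} e = begin
    suc (toℕ (f i)) ≡⟨ cong suc (f≡k+ i) ⟩
    suc (k + toℕ i) ≡⟨ sym (+-suc k (toℕ i)) ⟩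
    k + suc (toℕ i) ≡⟨ cong (k +_) e ⟩
    k + toℕ j       ≡⟨ sym (f≡k+ j) ⟩
    toℕ (f j)       ∎
  f-injective : ∀ {i j} → f i ≡ f j → i ≡ j
  f-injective {i} {j} e =
    toℕ-injective (+-cancelˡ-≡ k _ _ (trans (sym (f≡k+ i)) (trans (cong toℕ e) (f≡k+ j))))

third : Fin 3 → Fin 3 → Fin 3
third 0F 1F = 2F
third 1F 0F = 2F
third 0F 2F = 1F
third 2F 0F = 1F
third 1F 2F = 0F
third 2F 1F = 0F
third x  _  = x   -- junk: only reached when x ≡ y

third-unique : ∀ x y z → x ≢ y → z ≢ x → z ≢ y → z ≡ third x y
third-unique = from-yes (all? λ x → all? λ y → all? λ z →
  ¬? (x ≟ y) →-dec ¬? (z ≟ x) →-dec ¬? (z ≟ y) →-dec z ≟ third x y)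

next : SA → Fin 3 → Fin 3 → Fin 3
next S x y = x
next A x y = third x y

letter-next : ∀ {x y z} l → x ≢ y → y ≢ z → letter x z ≡ l → z ≡ next l x y
letter-next {x} {y} {z} _ x≢y y≢z refl with x ≟ z
... | yes x≡z = sym x≡z
... | no  x≢z = third-unique x y z x≢y (x≢z ∘ sym) (y≢z ∘ sym)

reconstruct : (u : List SA) → Fin 3 → Fin 3 → Fin (2 + length u) → Fin 3
reconstruct []      a b 0F     = a
reconstruct []      a b 1F     = b
reconstruct (l ∷ u) a b fz     = a
reconstruct (l ∷ u) a b (fs i) = reconstruct u b (next l a b) i

reconstruct-unique : ∀ u (d : Fin (2 + length u) → Fin 3) → Proper d → saSeq _ d ≡ u →
  ∀ i → d i ≡ reconstruct u (d 0F) (d 1F) i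
reconstruct-unique []      d proper eq 0F     = refl
reconstruct-unique []      d proper eq 1F     = refl
reconstruct-unique (l ∷ u) d proper eq fz     = refl
reconstruct-unique (l ∷ u) d proper eq (fs i) = begin
  d (fs i)
    ≡⟨ reconstruct-unique u (d ∘ fs) proper-tail (∷-injectiveʳ eq) i ⟩
  reconstruct u (d 1F) (d 2F) i
    ≡⟨ cong (λ z → reconstruct u (d 1F) z i) d₂≡next ⟩
  reconstruct u (d 1F) (next l (d 0F) (d 1F)) i ∎
  where
  proper-tail : Proper (d ∘ fs)
  proper-tail = proper ∘ Sum.map (cong suc) (cong suc)
  d₂≡next : d 2F ≡ next l (d 0F) (d 1F)
  d₂≡next = letter-next l (proper (inj₁ refl)) (proper (inj₁ refl)) (∷-injectiveˡ eq)

RepetitiveStroll : (u : List SA) → ℕ → (ℕ → Fin (2 + length u)) → Set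
RepetitiveStroll u t w =
  1 ≤ t × IsStroll t w × (∀ a b → a ≢ b → Repetitive t (λ i → reconstruct u a b (w i)))

Forbidden : List SA → Set
Forbidden u = (d : Fin (2 + length u) → Fin 3) → StrollNonrepetitive d → saSeq _ d ≢ u

repetitiveStroll⇒forbidden : ∀ {u t w} → RepetitiveStroll u t w → Forbidden u
repetitiveStroll⇒forbidden {u} {t} {w} (t≥1 , stroll , rep) d snr eq =
  snr t t≥1 w stroll λ i i<t → begin
    d (w i)                                 ≡⟨ determined (w i) ⟩
    reconstruct u (d 0F) (d 1F) (w i)       ≡⟨ rep (d 0F) (d 1F) (proper (inj₁ refl)) i i<t ⟩
    reconstruct u (d 0F) (d 1F) (w (i + t)) ≡⟨ sym (determined (w (i + t))) ⟩
    d (w (i + t))                           ∎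
  where
  proper : Proper d
  proper = strollNonrepetitive⇒proper snr
  determined : ∀ i → d i ≡ reconstruct u (d 0F) (d 1F) i
  determined = reconstruct-unique u d proper eq

bounded? : ∀ {P : ℕ → Set} → (∀ i → Dec (P i)) → ∀ n → Dec (∀ i → i < n → P i)
bounded? P? n = map′ (λ h i i<n → h i<n) (λ h {i} → h i) (allUpTo? P? n)

adj? : ∀ {n} (u v : Fin n) → Dec (Adj u v)
adj? u v = suc (toℕ u) ℕ.≟ toℕ v ⊎-dec suc (toℕ v) ℕ.≟ toℕ u

isWalk? : ∀ {n} r (w : ℕ → Fin n) → Dec (IsWalk r w)
isWalk? r w = map′ (λ h i i+1<r → h i (<-trans (n<1+n i) i+1<r) i+1<r) (λ h i _ → h i)
  (bounded? (λ i → suc i <? r →-dec adj? (w i) (w (suc i))) r)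

isStroll? : ∀ {n} t (w : ℕ → Fin n) → Dec (IsStroll t w)
isStroll? t w = isWalk? (t + t) w ×-dec bounded? (λ i → ¬? (w i ≟ w (i + t))) t

repetitive? : ∀ {n} t (a : ℕ → Fin n) → Dec (Repetitive t a)
repetitive? t a = bounded? (λ i → a i ≟ a (i + t)) t

repetitiveStroll? : ∀ u t w → Dec (RepetitiveStroll u t w)
repetitiveStroll? u t w = 1 ℕ.≤? t ×-dec isStroll? t w ×-dec
  all? λ a → all? λ b → ¬? (a ≟ b) →-dec repetitive? t (λ i → reconstruct u a b (w i))

saSeq-prefix : ∀ l u {n} (c : Fin n → Fin 3) s → saSeq n c ≡ l ∷ u ++ s →
  Σ[ le ∈ 3 + length u ≤ n ] saSeq _ (λ i → c (inject≤ i le)) ≡ l ∷ u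
saSeq-prefix l []       {suc (suc (suc n))} c s eq =
  s≤s (s≤s (s≤s z≤n)) , cong (_∷ []) (∷-injectiveˡ eq)
saSeq-prefix l (l′ ∷ u) {suc (suc (suc n))} c s eq with saSeq-prefix l′ u (c ∘ fs) s (∷-injectiveʳ eq)
... | le , eq′ = s≤s le , cong₂ _∷_ (∷-injectiveˡ eq) eq′
saSeq-prefix l u {zero}           c s ()
saSeq-prefix l u {suc zero}       c s ()
saSeq-prefix l u {suc (suc zero)} c s ()

forbidden⇒¬subword : ∀ {l u n} {c : Fin n → Fin 3} → Forbidden (l ∷ u) →
  StrollNonrepetitive c → ¬ Subword (l ∷ u) (saSeq n c)
forbidden⇒¬subword {l} {u} {c = c} forbidden snr ([] , s , eq) with saSeq-prefix l u c s eq
... | le , eq′ =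
  forbidden (c ∘ restrict) (strollNonrepetitive-subpath {c = c} 0 restrict (λ i → toℕ-inject≤ i le) snr) eq′
  where
  restrict : Fin (3 + length u) → Fin _
  restrict i = inject≤ i le
forbidden⇒¬subword {n = suc (suc (suc n))} {c} forbidden snr (_ ∷ p , s , eq) =
  forbidden⇒¬subword {c = c ∘ fs} forbidden (strollNonrepetitive-subpath {c = c} 1 fs (λ _ → refl) snr)
    (p , s , ∷-injectiveʳ eq)
forbidden⇒¬subword {n = zero}           _ _ (_ ∷ _ , _ , ())
forbidden⇒¬subword {n = suc zero}       _ _ (_ ∷ _ , _ , ())
forbidden⇒¬subword {n = suc (suc zero)} _ _ (_ ∷ _ , _ , ())

-- The walk v₁ v₂ ⋯ v_{L+1} v_L v_{L-1} ⋯ : to the last vertex and back.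
bounce : (L : ℕ) → ℕ → Fin (suc L)
bounce L i = fromℕ< (s≤s (m∸n≤m L ∣ L - i ∣))

excluded-by-bounce : ∀ {l u n} {c : Fin n → Fin 3} t →
  {True (repetitiveStroll? (l ∷ u) t (bounce _))} →
  StrollNonrepetitive c → ¬ Subword (l ∷ u) (saSeq n c)
excluded-by-bounce t {witness} = forbidden⇒¬subword (repetitiveStroll⇒forbidden (toWitness witness))

lemma9 : (n : ℕ) (c : Fin n → Fin 3) → StrollNonrepetitive c →
    Free ℋ (saSeq n c)
lemma9 n c snr _ (here refl)                                 = excluded-by-bounce 2 snr
lemma9 n c snr _ (there (here refl))                         = excluded-by-bounce 3 snr
lemma9 n c snr _ (there (there (here refl)))                 = excluded-by-bounce 4 snr
lemma9 n c snr _ (there (there (there (here refl))))         = excluded-by-bounce 6 snr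
lemma9 n c snr _ (there (there (there (there (here refl))))) = excluded-by-bounce 8 snr
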